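{- Let $1\le A, B \le q-1$ with $A + B \le q$. Then $$x_{Aq}\sqcup\!\sqcup x_{B(q-1)} = x_{Aq + B(q-1)}+ x_{B(q-1)}x_{Aq}.$$
   Context: Let $\mathbb F_q$ be the finite field with $q$ elements, of characteristic $p$. Let $\Sigma=\{x_n\}_{n\geq 1}$ be an alphabet; let $\langle\Sigma\rangle$ be the set of words over $\Sigma$ (the empty word is denoted $1$), and let $\mathfrak C=\mathbb F_q\langle\Sigma\rangle$ be the $\mathbb F_q$-vector space with basis $\langle\Sigma\rangle$, with concatenation product. A nonempty word is written $\mathfrak a=x_a\mathfrak a_-$. For $a,b,i\in\mathbb N$ put $\Delta^i_{a,b}=(-1)^{a-1}\binom{i-1}{a-1}+(-1)^{b-1}\binom{i-1}{b-1}\in\mathbb F_p$ if $(q-1)\mid i$ and $0<i<a+b$, and $\Delta^i_{a,b}=0$ otherwise. Define $\mathbb F_q$-bilinear products $\diamond$ (diamond) and $\sqcup\!\sqcup$ (shuffle) on $\mathfrak C$ recursively by $1\diamond\mathfrak a=\mathfrak a\diamond 1=\mathfrak a$, $1\sqcup\!\sqcup\mathfrak a=\mathfrak a\sqcup\!\sqcup 1=\mathfrak a$, and for nonempty words $\mathfrak a,\mathfrak b$: $\mathfrak a\diamond\mathfrak b=x_{a+b}(\mathfrak a_-\sqcup\!\sqcup\mathfrak b_-)+\sum_{i+j=a+b}\Delta^j_{a,b}\,x_i(x_j\sqcup\!\sqcup(\mathfrak a_-\sqcup\!\sqcup\mathfrak b_-))$, $\mathfrak a\sqcup\!\sqcup\mathfrak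 b=x_a(\mathfrak a_-\sqcup\!\sqcup\mathfrak b)+x_b(\mathfrak a\sqcup\!\sqcup\mathfrak b_-)+\mathfrak a\diamond\mathfrak b$. In particular for letters, $x_u\sqcup\!\sqcup x_v=x_{u+v}+x_ux_v+x_vx_u+\sum_{0<j<u+v}\Delta^j_{u,v}x_{u+v-j}x_j$. -}

module Defs where

open import Data.Nat as ℕ using (ℕ; zero; suc; _∸_; _≤_; _<_)
open import Data.Nat.Combinatorics using (_C_)
open import Data.Nat.Divisibility as ℕD using ()
open import Data.Integer as ℤ using (ℤ; +_; _-_)
open import Data.Integer.Divisibility as ℤD using ()
open import Data.List using (List; []; _∷_; map; concatMap; upTo; length; foldr; [_])
open import Data.List.Properties using (≡-dec)
open import Data.Product using (_×_; _,_)
open import Relation.Nullary using (Dec; yes; no)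
open import Relation.Binary.PropositionalEquality using (_≡_)

-- A word over Σ = {x_n}: the list of letter indices (x_a x_b ... ↦ a ∷ b ∷ ...).
Word : Set
Word = List ℕ

-- An element of F_q⟨Σ⟩ with coefficients in the prime field, represented by
-- integer lifts: a finite formal sum  Σ c · w.
LC : Set
LC = List (ℤ × Word)

coeff : Word → LC → ℤ
coeff w [] = + 0
coeff w ((c , u) ∷ xs) with ≡-dec ℕ._≟_ w u
... | yes _ = c ℤ.+ coeff w xs
... | no _ = coeff w xs

-- equality in F_q⟨Σ⟩ (characteristic p): all coefficients agree modulo p
_≈[_]_ : LC → ℕ → LC → Set
X ≈[ p ] Y = ∀ (w : Word) → (+ p) ℤD.∣ (coeff w X - coeff w Y)

letter : ℕ → LC
letter a = [ (+ 1 , [ a ]) ]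

word2 : ℕ → ℕ → LC
word2 a b = [ (+ 1 , a ∷ b ∷ []) ]

_⊕_ : LC → LC → LC
X ⊕ Y = foldr _∷_ Y X

scale : ℤ → LC → LC
scale c = map (λ { (d , w) → (c ℤ.* d , w) })

prefix : ℕ → LC → LC
prefix a = map (λ { (d , w) → (d , a ∷ w) })

negOnePow : ℕ → ℤ
negOnePow zero = + 1
negOnePow (suc k) = ℤ.- negOnePow k

Δ : (q a b i : ℕ) → ℤ
Δ q a b i with ℕD._∣?_ (q ∸ 1) i | 0 ℕ.<? i | i ℕ.<? a ℕ.+ b
... | yes _ | yes _ | yes _ =
  negOnePow (a ∸ 1) ℤ.* (+ ((i ∸ 1) C (a ∸ 1)))
  ℤ.+ negOnePow (b ∸ 1) ℤ.* (+ ((i ∸ 1) C (b ∸ 1)))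
... | _ | _ | _ = + 0

-- shuffle and diamond products on words, with a fuel argument
-- (recursion on total length; the fuel used below is always sufficient)
mutual
  shF : (q fuel : ℕ) → Word → Word → LC
  shF q zero a b = []
  shF q (suc n) [] b = [ (+ 1 , b) ]
  shF q (suc n) (a ∷ as) [] = [ (+ 1 , a ∷ as) ]
  shF q (suc n) (a ∷ as) (b ∷ bs) =
    prefix a (shF q n as (b ∷ bs)) ⊕ (prefix b (shF q n (a ∷ as) bs) ⊕ diaF q n (a ∷ as) (b ∷ bs))

  diaF : (q fuel : ℕ) → Word → Word → LC
  diaF q zero a b = []
  diaF q (suc n) [] b = [ (+ 1 , b) ]
  diaF q (suc n) (a ∷ as) [] = [ (+ 1 , a ∷ as) ]
  diaF q (suc n) (a ∷ as) (b ∷ bs) =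
    prefix (a ℕ.+ b) (shF q n as bs)
    ⊕ concatMap (λ j → scale (Δ q a b j) (prefix (a ℕ.+ b ∸ j) (shLCF q n [ (+ 1 , [ j ]) ] (shF q n as bs))))
                (upTo (a ℕ.+ b))

  shLCF : (q fuel : ℕ) → LC → LC → LC
  shLCF q n X Y = concatMap (λ { (c , u) → concatMap (λ { (d , v) → scale (c ℤ.* d) (shF q n u v) }) Y }) X

fuel : Word → Word → ℕ
fuel a b = 2 ℕ.* (length a ℕ.+ length b) ℕ.+ 2

sh : (q : ℕ) → Word → Word → LC
sh q a b = shF q (fuel a b) a b

_⧢[_]_ : LC → ℕ → LC → LC
X ⧢[ q ] Y = concatMap (λ { (c , u) → concatMap (λ { (d , v) → scale (c ℤ.* d) (sh q u v) }) Y }) X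

-- For letters the shuffle product is x_a ⧢ x_b = x_{a+b} + x_a x_b + x_b x_a + Σ_j Δ^j_{a,b} x_{a+b-j} x_j,
-- so for a = Aq and b = B(q-1) it suffices that Δ^j ≡ -[j = b] (mod p).  Only j = m(q-1) with 0 < j < a + b
-- contribute.  As q = p^k, the binomials C(q,i) with 0 < i < q vanish mod p; this yields Lucas' theorem in
-- base q and C(q-1,i) ≡ (-1)^i.  In base q, a - 1 has digits (A-1, q-1), b - 1 has digits (B-1, q-B-1) and,
-- for m < q, j - 1 has digits (m-1, q-m-1).  Hence C(j-1,a-1) ≡ 0 and C(j-1,b-1) ≡ [m = B], and the sign
-- (-1)^{b-1} is -1.  For m > q we have j ≥ a + b, and m = q needs A + B = q; then the two terms of Δ^j
-- cancel because C(q-2,A-1) = C(q-2,B-1) and (-1)^{a-1} = (-1)^{A-1}.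
module Submission where

open import Defs
open import Data.Empty using (⊥-elim)
open import Data.Integer as ℤ using (ℤ; +_; -_; _-_; -1ℤ)
import Data.Integer.Properties as ℤP
open import Algebra.Properties.CommutativeSemigroup ℤP.+-commutativeSemigroup using (interchange)
open import Data.Integer.Divisibility.Signed as ℤ∣ using (_∣_; ∣ᵤ⇒∣; ∣⇒∣ᵤ; ∣m∣n⇒∣m+n; ∣m⇒∣-m; ∣m⇒∣m*n; ∣n⇒∣m*n)
import Data.Integer.Tactic.RingSolver as ℤ-Solver
open import Data.List using (List; []; _∷_; _++_; map; concatMap; foldr; upTo; applyUpTo)
open import Data.List.Properties using (≡-dec; ++-identityʳ; map-applyUpTo)
open import Data.Nat as ℕ using (ℕ; zero; suc; _+_; _*_; _∸_; _^_; _≤_; _<_; z≤n; s≤s; _!; NonZero)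
open import Data.Nat.Combinatorics using (_C_; nCn≡1; nCk≡nC[n∸k]; nCk+nC[k+1]≡[n+1]C[k+1]; k![n∸k]!∣n!)
open import Data.Nat.Combinatorics.Specification using (k>n⇒nCk≡0; nCk≡n!/k![n-k]!)
import Data.Nat.Divisibility as ℕ∣
open import Data.Nat.DivMod using (_/_; _%_; m/n*n≡m; m≡m%n+[m/n]*n; m%n<n)
open import Data.Nat.Primality using (Prime; euclidsLemma; prime⇒nonTrivial; prime⇒nonZero)
open import Data.Nat.Properties
open import Data.Nat.Tactic.RingSolver using (solve-∀)
open import Data.Product using (_,_)
open import Data.Sum using (inj₁; inj₂)
open import Function using (id; _∘_)
open import Relation.Binary.Bundles using (Setoid)
open import Relation.Binary.Definitions using (tri<; tri≈; tri>)
open import Relation.Binary.PropositionalEquality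
  using (_≡_; _≢_; refl; sym; trans; cong; cong₂; subst; module ≡-Reasoning)
import Relation.Binary.Reasoning.Setoid as SetoidReasoning
open import Relation.Nullary using (¬_; yes; no)

sumℤ : List ℤ → ℤ
sumℤ = foldr ℤ._+_ (+ 0)

negOnePow-+ : ∀ m n → negOnePow (m + n) ≡ negOnePow m ℤ.* negOnePow n
negOnePow-+ zero    n = sym (ℤP.*-identityˡ (negOnePow n))
negOnePow-+ (suc m) n = trans (cong -_ (negOnePow-+ m n)) (ℤP.neg-distribˡ-* (negOnePow m) (negOnePow n))

pascal : ∀ n k → + (suc n C suc k) ≡ + (n C k) ℤ.+ + (n C suc k)
pascal n k = cong +_ (sym (nCk+nC[k+1]≡[n+1]C[k+1] n k))

nCk*k!*[n∸k]!≡n! : ∀ {n k} → k ≤ n → (n C k) * (k ! * (n ∸ k) !) ≡ n !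
nCk*k!*[n∸k]!≡n! {n} {k} k≤n =
  trans (cong (_* (k ! * (n ∸ k) !)) (nCk≡n!/k![n-k]! k≤n)) (m/n*n≡m {{k !* (n ∸ k) !≢0}} (k![n∸k]!∣n! k≤n))

[1+t]q+n≡tq+n+q : ∀ t n q → suc t * q + n ≡ t * q + n + q
[1+t]q+n≡tq+n+q = solve-∀

n∣n! : ∀ n → .{{NonZero n}} → n ℕ∣.∣ n !
n∣n! (suc n) = ℕ∣.m∣m*n (n !)

coeff-++ : ∀ w X Y → coeff w (X ++ Y) ≡ coeff w X ℤ.+ coeff w Y
coeff-++ w []            Y = sym (ℤP.+-identityˡ (coeff w Y))
coeff-++ w ((c , u) ∷ X) Y with ≡-dec ℕ._≟_ w u
... | yes _ = trans (cong (λ t → c ℤ.+ t) (coeff-++ w X Y)) (sym (ℤP.+-assoc c (coeff w X) (coeff w Y)))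
... | no _  = coeff-++ w X Y

coeff-scale : ∀ w c X → coeff w (scale c X) ≡ c ℤ.* coeff w X
coeff-scale w c []            = sym (ℤP.*-zeroʳ c)
coeff-scale w c ((d , u) ∷ X) with ≡-dec ℕ._≟_ w u
... | yes _ = trans (cong (λ t → c ℤ.* d ℤ.+ t) (coeff-scale w c X)) (sym (ℤP.*-distribˡ-+ c d (coeff w X)))
... | no _  = coeff-scale w c X

coeff-concatMap-scale : ∀ {A : Set} w (f : A → ℤ) (X : A → LC) xs →
  coeff w (concatMap (λ x → scale (f x) (X x)) xs) ≡ sumℤ (map (λ x → f x ℤ.* coeff w (X x)) xs)
coeff-concatMap-scale w f X []       = refl
coeff-concatMap-scale w f X (x ∷ xs) = begin
  coeff w (scale (f x) (X x) ++ concatMap (λ x → scale (f x) (X x)) xs)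
    ≡⟨ coeff-++ w (scale (f x) (X x)) _ ⟩
  coeff w (scale (f x) (X x)) ℤ.+ coeff w (concatMap (λ x → scale (f x) (X x)) xs)
    ≡⟨ cong₂ ℤ._+_ (coeff-scale w (f x) (X x)) (coeff-concatMap-scale w f X xs) ⟩
  f x ℤ.* coeff w (X x) ℤ.+ sumℤ (map (λ x → f x ℤ.* coeff w (X x)) xs) ∎
  where open ≡-Reasoning

-- letter a ⧢[ q ] letter b unfolds definitionally to the list in the second step, up to two trailing ++ [].
coeff-letter-⧢-letter : ∀ q a b w →
  coeff w (letter a ⧢[ q ] letter b) ≡
  coeff w (word2 a b) ℤ.+ (coeff w (word2 b a) ℤ.+ (coeff w (letter (a + b)) ℤ.+
    sumℤ (map (λ j → Δ q a b j ℤ.* coeff w (word2 (a + b ∸ j) j)) (upTo (a + b)))))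
coeff-letter-⧢-letter q a b w = begin
  coeff w (letter a ⧢[ q ] letter b)
    ≡⟨ cong (coeff w) (trans (++-identityʳ _) (++-identityʳ _)) ⟩
  coeff w (word2 a b ++ word2 b a ++ letter (a + b) ++ scale (+ 1) Δ-terms)
    ≡⟨ coeff-++ w (word2 a b) _ ⟩
  x ℤ.+ coeff w (word2 b a ++ letter (a + b) ++ scale (+ 1) Δ-terms)
    ≡⟨ cong (λ t → x ℤ.+ t) (coeff-++ w (word2 b a) _) ⟩
  x ℤ.+ (y ℤ.+ coeff w (letter (a + b) ++ scale (+ 1) Δ-terms))
    ≡⟨ cong (λ t → x ℤ.+ (y ℤ.+ t)) (coeff-++ w (letter (a + b)) _) ⟩
  x ℤ.+ (y ℤ.+ (z ℤ.+ coeff w (scale (+ 1) Δ-terms)))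
    ≡⟨ cong (λ t → x ℤ.+ (y ℤ.+ (z ℤ.+ t))) (trans (coeff-scale w (+ 1) Δ-terms) (ℤP.*-identityˡ _)) ⟩
  x ℤ.+ (y ℤ.+ (z ℤ.+ coeff w Δ-terms))
    ≡⟨ cong (λ t → x ℤ.+ (y ℤ.+ (z ℤ.+ t))) (coeff-concatMap-scale w (Δ q a b) _ (upTo (a + b))) ⟩
  x ℤ.+ (y ℤ.+ (z ℤ.+ sumℤ (map (λ j → Δ q a b j ℤ.* coeff w (word2 (a + b ∸ j) j)) (upTo (a + b))))) ∎
  where
  open ≡-Reasoning
  Δ-terms : LC
  Δ-terms = concatMap (λ j → scale (Δ q a b j) (word2 (a + b ∸ j) j)) (upTo (a + b))
  x y z : ℤ
  x = coeff w (word2 a b)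
  y = coeff w (word2 b a)
  z = coeff w (letter (a + b))

Δ-formula : ℕ → ℕ → ℕ → ℤ
Δ-formula a b i =
  negOnePow (a ∸ 1) ℤ.* (+ ((i ∸ 1) C (a ∸ 1))) ℤ.+ negOnePow (b ∸ 1) ℤ.* (+ ((i ∸ 1) C (b ∸ 1)))

Δ-on-support : ∀ q a b i → (q ∸ 1) ℕ∣.∣ i → 0 < i → i < a + b → Δ q a b i ≡ Δ-formula a b i
Δ-on-support q a b i q-1∣i 0<i i<a+b with (q ∸ 1) ℕ∣.∣? i | 0 ℕ.<? i | i ℕ.<? a + b
... | yes _ | yes _ | yes _     = refl
... | no q-1∤i | _ | _          = ⊥-elim (q-1∤i q-1∣i)
... | yes _ | no 0≮i | _        = ⊥-elim (0≮i 0<i)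
... | yes _ | yes _ | no i≮a+b  = ⊥-elim (i≮a+b i<a+b)

module Modulo (p : ℕ) where

  infix 4 _≡ₚ_
  record _≡ₚ_ (x y : ℤ) : Set where
    constructor divides-difference
    field p∣x-y : + p ∣ x - y
  open _≡ₚ_ public

  private
    by : ∀ {m n} → m ≡ n → + p ∣ m → + p ∣ n
    by = subst (+ p ∣_)

    neg-difference : ∀ x y → - (x - y) ≡ y - x
    neg-difference = ℤ-Solver.solve-∀

    telescope : ∀ x y z → (x - y) ℤ.+ (y - z) ≡ x - z
    telescope = ℤ-Solver.solve-∀

    sum-difference : ∀ x y x′ y′ → (x - x′) ℤ.+ (y - y′) ≡ (x ℤ.+ y) - (x′ ℤ.+ y′)
    sum-difference = ℤ-Solver.solve-∀

    product-difference : ∀ x y x′ y′ → (x - x′) ℤ.* y ℤ.+ x′ ℤ.* (y - y′) ≡ x ℤ.* y - x′ ℤ.* y′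
    product-difference = ℤ-Solver.solve-∀

    neg-neg-difference : ∀ x y → - (x - y) ≡ - x - - y
    neg-neg-difference = ℤ-Solver.solve-∀

  ≡⇒≡ₚ : ∀ {x y} → x ≡ y → x ≡ₚ y
  ≡⇒≡ₚ {x} refl = divides-difference (ℤ∣.divides (+ 0) (ℤP.+-inverseʳ x))

  ≡ₚ-sym : ∀ {x y} → x ≡ₚ y → y ≡ₚ x
  ≡ₚ-sym {x} {y} (divides-difference d) = divides-difference (by (neg-difference x y) (∣m⇒∣-m d))

  ≡ₚ-trans : ∀ {x y z} → x ≡ₚ y → y ≡ₚ z → x ≡ₚ z
  ≡ₚ-trans {x} {y} {z} (divides-difference d) (divides-difference e) =
    divides-difference (by (telescope x y z) (∣m∣n⇒∣m+n d e))

  ≡ₚ-setoid : Setoid _ _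
  ≡ₚ-setoid = record
    { Carrier = ℤ
    ; _≈_ = _≡ₚ_
    ; isEquivalence = record { refl = ≡⇒≡ₚ refl ; sym = ≡ₚ-sym ; trans = ≡ₚ-trans }
    }

  open SetoidReasoning ≡ₚ-setoid

  ≡ₚ-refl : ∀ {x} → x ≡ₚ x
  ≡ₚ-refl = ≡⇒≡ₚ refl

  +-cong : ∀ {x y x′ y′} → x ≡ₚ x′ → y ≡ₚ y′ → x ℤ.+ y ≡ₚ x′ ℤ.+ y′
  +-cong {x} {y} {x′} {y′} (divides-difference d) (divides-difference e) =
    divides-difference (by (sum-difference x y x′ y′) (∣m∣n⇒∣m+n d e))

  *-cong : ∀ {x y x′ y′} → x ≡ₚ x′ → y ≡ₚ y′ → x ℤ.* y ≡ₚ x′ ℤ.* y′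
  *-cong {x} {y} {x′} {y′} (divides-difference d) (divides-difference e) =
    divides-difference (by (product-difference x y x′ y′) (∣m∣n⇒∣m+n (∣m⇒∣m*n y d) (∣n⇒∣m*n x′ e)))

  -‿cong : ∀ {x y} → x ≡ₚ y → - x ≡ₚ - y
  -‿cong {x} {y} (divides-difference d) = divides-difference (by (neg-neg-difference x y) (∣m⇒∣-m d))

  ∣⇒≡ₚ0 : ∀ {n} → p ℕ∣.∣ n → + n ≡ₚ + 0
  ∣⇒≡ₚ0 {n} p∣n = divides-difference (by (sym (ℤP.+-identityʳ (+ n))) (∣ᵤ⇒∣ p∣n))

  sumℤ-applyUpTo-≡ₚ0 : ∀ f n → (∀ j → f j ≡ₚ + 0) → sumℤ (applyUpTo f n) ≡ₚ + 0
  sumℤ-applyUpTo-≡ₚ0 f zero    f≡ₚ0 = ≡ₚ-refl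
  sumℤ-applyUpTo-≡ₚ0 f (suc n) f≡ₚ0 = +-cong (f≡ₚ0 0) (sumℤ-applyUpTo-≡ₚ0 (f ∘ suc) n (f≡ₚ0 ∘ suc))

  sumℤ-applyUpTo-single : ∀ f n i → i < n → (∀ j → j ≢ i → f j ≡ₚ + 0) → sumℤ (applyUpTo f n) ≡ₚ f i
  sumℤ-applyUpTo-single f (suc n) zero    _        f≡ₚ0 = begin
    f 0 ℤ.+ sumℤ (applyUpTo (f ∘ suc) n)
      ≈⟨ +-cong (≡ₚ-refl {f 0}) (sumℤ-applyUpTo-≡ₚ0 (f ∘ suc) n (λ j → f≡ₚ0 (suc j) λ ())) ⟩
    f 0 ℤ.+ + 0 ≡⟨ ℤP.+-identityʳ (f 0) ⟩
    f 0         ∎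
  sumℤ-applyUpTo-single f (suc n) (suc i) (s≤s i<n) f≡ₚ0 = begin
    f 0 ℤ.+ sumℤ (applyUpTo (f ∘ suc) n)
      ≈⟨ +-cong (f≡ₚ0 0 λ ())
                (sumℤ-applyUpTo-single (f ∘ suc) n i i<n (λ j j≢i → f≡ₚ0 (suc j) (j≢i ∘ suc-injective))) ⟩
    + 0 ℤ.+ f (suc i) ≡⟨ ℤP.+-identityˡ (f (suc i)) ⟩
    f (suc i)         ∎

  Δ≡ₚ0 : ∀ q a b i → (∀ m → i ≡ m * (q ∸ 1) → 0 < i → i < a + b → Δ-formula a b i ≡ₚ + 0) →
         Δ q a b i ≡ₚ + 0
  Δ≡ₚ0 q a b i formula≡ₚ0 with (q ∸ 1) ℕ∣.∣? i | 0 ℕ.<? i | i ℕ.<? a + b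
  ... | yes (ℕ∣.divides m i≡m[q-1]) | yes 0<i | yes i<a+b = formula≡ₚ0 m i≡m[q-1] 0<i i<a+b
  ... | no _  | _     | _     = ≡ₚ-refl
  ... | yes _ | no _  | _     = ≡ₚ-refl
  ... | yes _ | yes _ | no _  = ≡ₚ-refl

  Δ-formula≡ₚ0 : ∀ a b i → + ((i ∸ 1) C (a ∸ 1)) ≡ₚ + 0 → + ((i ∸ 1) C (b ∸ 1)) ≡ₚ + 0 →
                 Δ-formula a b i ≡ₚ + 0
  Δ-formula≡ₚ0 a b i Ca≡ₚ0 Cb≡ₚ0 = begin
    Δ-formula a b i
      ≈⟨ +-cong (*-cong (≡ₚ-refl {negOnePow (a ∸ 1)}) Ca≡ₚ0) (*-cong (≡ₚ-refl {negOnePow (b ∸ 1)}) Cb≡ₚ0) ⟩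
    negOnePow (a ∸ 1) ℤ.* + 0 ℤ.+ negOnePow (b ∸ 1) ℤ.* + 0
      ≡⟨ cong₂ ℤ._+_ (ℤP.*-zeroʳ (negOnePow (a ∸ 1))) (ℤP.*-zeroʳ (negOnePow (b ∸ 1))) ⟩
    + 0 ∎

  -- Satisfied by the powers of a prime p; it is what makes (x + y)^q = x^q + y^q in characteristic p.
  Frobenius : ℕ → Set
  Frobenius q = ∀ i → 0 < i → i < q → + (q C i) ≡ₚ + 0

  module Lucas (q′ : ℕ) (frob : Frobenius (suc q′)) where

    q : ℕ
    q = suc q′

    C-shift-low : ∀ n m → m < q → + ((n + q) C m) ≡ₚ + (n C m)
    C-shift-low zero    zero    _   = ≡ₚ-refl
    C-shift-low zero    (suc m) m<q = frob (suc m) (s≤s z≤n) m<q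
    C-shift-low (suc n) zero    _   = ≡ₚ-refl
    C-shift-low (suc n) (suc m) m<q = begin
      + (suc (n + q) C suc m)                    ≡⟨ pascal (n + q) m ⟩
      + ((n + q) C m) ℤ.+ + ((n + q) C suc m)   ≈⟨ +-cong (C-shift-low n m (<-trans (n<1+n m) m<q))
                                                            (C-shift-low n (suc m) m<q) ⟩
      + (n C m) ℤ.+ + (n C suc m)               ≡⟨ pascal n m ⟨
      + (suc n C suc m)                          ∎

    C-shift-high : ∀ n m → + ((n + q) C (m + q)) ≡ₚ + (n C (m + q)) ℤ.+ + (n C m)
    C-shift-high zero    zero    = ≡⇒≡ₚ (cong +_ (nCn≡1 q))
    C-shift-high zero    (suc m) = ≡⇒≡ₚ (cong +_ (k>n⇒nCk≡0 (s≤s (m≤n+m q m))))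
    C-shift-high (suc n) zero    = begin
      + (suc (n + q) C suc q′)                                 ≡⟨ pascal (n + q) q′ ⟩
      + ((n + q) C q′) ℤ.+ + ((n + q) C q)                    ≈⟨ +-cong (C-shift-low n q′ ≤-refl) (C-shift-high n 0) ⟩
      + (n C q′) ℤ.+ (+ (n C q) ℤ.+ + 1)                      ≡⟨ ℤP.+-assoc (+ (n C q′)) (+ (n C q)) (+ 1) ⟨
      + (n C q′) ℤ.+ + (n C q) ℤ.+ + 1                        ≡⟨ cong (λ t → t ℤ.+ + 1) (pascal n q′) ⟨
      + (suc n C q) ℤ.+ + 1                                    ∎
    C-shift-high (suc n) (suc m) = begin
      + (suc (n + q) C suc (m + q))
        ≡⟨ pascal (n + q) (m + q) ⟩
      + ((n + q) C (m + q)) ℤ.+ + ((n + q) C (suc m + q))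
        ≈⟨ +-cong (C-shift-high n m) (C-shift-high n (suc m)) ⟩
      (+ (n C (m + q)) ℤ.+ + (n C m)) ℤ.+ (+ (n C suc (m + q)) ℤ.+ + (n C suc m))
        ≡⟨ interchange (+ (n C (m + q))) (+ (n C m)) (+ (n C suc (m + q))) (+ (n C suc m)) ⟩
      (+ (n C (m + q)) ℤ.+ + (n C suc (m + q))) ℤ.+ (+ (n C m) ℤ.+ + (n C suc m))
        ≡⟨ cong₂ ℤ._+_ (pascal n (m + q)) (pascal n m) ⟨
      + (suc n C suc (m + q)) ℤ.+ + (suc n C suc m) ∎

    lucas : ∀ t s {n₀ m₀} → n₀ < q → m₀ < q →
            + ((t * q + n₀) C (s * q + m₀)) ≡ₚ + ((t C s) * (n₀ C m₀))
    lucas zero    zero    {n₀} {m₀} _    _    = ≡⇒≡ₚ (cong +_ (sym (*-identityˡ (n₀ C m₀))))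
    lucas zero    (suc s) {n₀} {m₀} n₀<q _    =
      ≡⇒≡ₚ (cong +_ (k>n⇒nCk≡0 (≤-trans n₀<q (≤-trans (m≤m+n q (s * q)) (m≤m+n _ m₀)))))
    lucas (suc t) zero    {n₀} {m₀} n₀<q m₀<q = begin
      + ((suc t * q + n₀) C m₀)      ≡⟨ cong (λ n → + (n C m₀)) ([1+t]q+n≡tq+n+q t n₀ q) ⟩
      + ((t * q + n₀ + q) C m₀)      ≈⟨ C-shift-low (t * q + n₀) m₀ m₀<q ⟩
      + ((t * q + n₀) C m₀)          ≈⟨ lucas t zero n₀<q m₀<q ⟩
      + ((t C 0) * (n₀ C m₀))        ∎
    lucas (suc t) (suc s) {n₀} {m₀} n₀<q m₀<q = begin
      + ((suc t * q + n₀) C (suc s * q + m₀))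
        ≡⟨ cong₂ (λ n k → + (n C k)) ([1+t]q+n≡tq+n+q t n₀ q) ([1+t]q+n≡tq+n+q s m₀ q) ⟩
      + ((t * q + n₀ + q) C (s * q + m₀ + q))
        ≈⟨ C-shift-high (t * q + n₀) (s * q + m₀) ⟩
      + ((t * q + n₀) C (s * q + m₀ + q)) ℤ.+ + ((t * q + n₀) C (s * q + m₀))
        ≡⟨ cong (λ k → + ((t * q + n₀) C k) ℤ.+ + ((t * q + n₀) C (s * q + m₀))) ([1+t]q+n≡tq+n+q s m₀ q) ⟨
      + ((t * q + n₀) C (suc s * q + m₀)) ℤ.+ + ((t * q + n₀) C (s * q + m₀))
        ≈⟨ +-cong (lucas t (suc s) n₀<q m₀<q) (lucas t s n₀<q m₀<q) ⟩
      + ((t C suc s) * (n₀ C m₀) + (t C s) * (n₀ C m₀))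
        ≡⟨ cong +_ (sym (*-distribʳ-+ (n₀ C m₀) (t C suc s) (t C s))) ⟩
      + ((t C suc s + t C s) * (n₀ C m₀))
        ≡⟨ cong (λ c → + (c * (n₀ C m₀))) (trans (+-comm (t C suc s) (t C s)) (nCk+nC[k+1]≡[n+1]C[k+1] t s)) ⟩
      + ((suc t C suc s) * (n₀ C m₀)) ∎

    C-pred-alternating : ∀ i → i < q → + (q′ C i) ≡ₚ negOnePow i
    C-pred-alternating zero    _   = ≡ₚ-refl
    C-pred-alternating (suc i) i<q = begin
      + (q′ C suc i)                          ≡⟨ add-sub (+ (q′ C i)) (+ (q′ C suc i)) ⟩
      + (q′ C i) ℤ.+ + (q′ C suc i) - + (q′ C i) ≡⟨ cong (λ t → t - + (q′ C i)) (pascal q′ i) ⟨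
      + (q C suc i) - + (q′ C i)              ≈⟨ +-cong (frob (suc i) (s≤s z≤n) i<q)
                                                         (-‿cong (C-pred-alternating i (<-trans (n<1+n i) i<q))) ⟩
      + 0 ℤ.+ - negOnePow i                   ≡⟨ ℤP.+-identityˡ (- negOnePow i) ⟩
      negOnePow (suc i)                       ∎
      where add-sub : ∀ x y → y ≡ x ℤ.+ y - x
            add-sub = ℤ-Solver.solve-∀

    negOnePow-q′≡ₚ1 : negOnePow q′ ≡ₚ + 1
    negOnePow-q′≡ₚ1 = begin
      negOnePow q′ ≈⟨ C-pred-alternating q′ ≤-refl ⟨
      + (q′ C q′)  ≡⟨ cong +_ (nCn≡1 q′) ⟩
      + 1          ∎

    negOnePow-*q′≡ₚ1 : ∀ m → negOnePow (m * q′) ≡ₚ + 1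
    negOnePow-*q′≡ₚ1 zero    = ≡ₚ-refl
    negOnePow-*q′≡ₚ1 (suc m) = begin
      negOnePow (q′ + m * q′)                     ≡⟨ negOnePow-+ q′ (m * q′) ⟩
      negOnePow q′ ℤ.* negOnePow (m * q′)         ≈⟨ *-cong negOnePow-q′≡ₚ1 (negOnePow-*q′≡ₚ1 m) ⟩
      + 1                                          ∎

    negOnePow-*q≡ₚ : ∀ m → negOnePow (m * q) ≡ₚ negOnePow m
    negOnePow-*q≡ₚ m = begin
      negOnePow (m * suc q′)                  ≡⟨ trans (cong negOnePow (*-suc m q′)) (negOnePow-+ m (m * q′)) ⟩
      negOnePow m ℤ.* negOnePow (m * q′)      ≈⟨ *-cong (≡ₚ-refl {negOnePow m}) (negOnePow-*q′≡ₚ1 m) ⟩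
      negOnePow m ℤ.* + 1                     ≡⟨ ℤP.*-identityʳ (negOnePow m) ⟩
      negOnePow m                             ∎

  module PrimePower (p-prime : Prime p) where

    private
      instance
        p≢0 : NonZero p
        p≢0 = prime⇒nonZero p-prime

    p∤n! : ∀ {n} → n < p → ¬ p ℕ∣.∣ n !
    p∤n! {zero}  _   p∣1 = <⇒≢ (ℕ.nonTrivial⇒n>1 p {{prime⇒nonTrivial p-prime}}) (sym (ℕ∣.∣1⇒≡1 p∣1))
    p∤n! {suc n} n<p p∣[1+n]! with euclidsLemma (suc n) (n !) p-prime p∣[1+n]!
    ... | inj₁ p∣1+n = <⇒≱ n<p (ℕ∣.∣⇒≤ p∣1+n)
    ... | inj₂ p∣n!  = p∤n! (<-trans (n<1+n n) n<p) p∣n!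

    p∣pCi : ∀ {i} → 0 < i → i < p → p ℕ∣.∣ p C i
    p∣pCi {i} 0<i i<p with euclidsLemma (p C i) (i ! * (p ∸ i) !) p-prime
                            (subst (p ℕ∣.∣_) (sym (nCk*k!*[n∸k]!≡n! (<⇒≤ i<p))) (n∣n! p))
    ... | inj₁ p∣pCi = p∣pCi
    ... | inj₂ p∣i![p∸i]! with euclidsLemma (i !) ((p ∸ i) !) p-prime p∣i![p∸i]!
    ...   | inj₁ p∣i!     = ⊥-elim (p∤n! i<p p∣i!)
    ...   | inj₂ p∣[p∸i]! = ⊥-elim (p∤n! (∸-monoʳ-< 0<i (<⇒≤ i<p)) p∣[p∸i]!)

    frobenius-prime : Frobenius p
    frobenius-prime i 0<i i<p = ∣⇒≡ₚ0 (p∣pCi 0<i i<p)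

    frobenius-* : ∀ q′ → Frobenius (suc q′) → Frobenius (p * suc q′)
    frobenius-* q′ frob i 0<i i<pq = begin
      + ((p * q) C i)                        ≡⟨ cong₂ (λ n k → + (n C k)) (sym (+-identityʳ (p * q))) i≡s*q+m ⟩
      + ((p * q + 0) C (s * q + i % q))     ≈⟨ lucas p s (s≤s z≤n) (m%n<n i q) ⟩
      + ((p C s) * (0 C (i % q)))           ≈⟨ low-digit-vanishes (i % q) (sym i≡s*q+m) ⟩
      + 0                                    ∎
      where
      open Lucas q′ frob
      s : ℕ
      s = i / q
      i≡s*q+m : i ≡ s * q + i % q
      i≡s*q+m = trans (m≡m%n+[m/n]*n i q) (+-comm (i % q) (s * q))
      low-digit-vanishes : ∀ m → s * q + m ≡ i → + ((p C s) * (0 C m)) ≡ₚ + 0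
      low-digit-vanishes (suc m) _      = ≡⇒≡ₚ (cong +_ (*-zeroʳ (p C s)))
      low-digit-vanishes zero    s*q+0≡i = begin
        + ((p C s) * 1) ≡⟨ cong +_ (*-identityʳ (p C s)) ⟩
        + (p C s)       ≈⟨ frobenius-prime s 0<s s<p ⟩
        + 0             ∎
        where
        s*q≡i : s * q ≡ i
        s*q≡i = trans (sym (+-identityʳ (s * q))) s*q+0≡i
        0<s : 0 < s
        0<s = *-cancelʳ-< q 0 s (subst (0 <_) (sym s*q≡i) 0<i)
        s<p : s < p
        s<p = *-cancelʳ-< q s p (subst (_< p * q) (sym s*q≡i) i<pq)

    frobenius-^ : ∀ k → Frobenius (p ^ k)
    frobenius-^ zero i 0<i i<1 = ⊥-elim (<⇒≱ 0<i (≤-pred i<1))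
    frobenius-^ (suc k) with p ^ k | frobenius-^ k
    ... | zero   | _    = λ i _ i<0 → ⊥-elim (n≮0 (subst (i <_) (*-zeroʳ p) i<0))
    ... | suc q′ | frob = frobenius-* q′ frob

  -- a = Aq and b = B(q-1) with A = A′ + 1, B = B′ + 1 and q = A + B + γ.
  module LetterShuffle (A′ B′ γ : ℕ) (frob : Frobenius (2 + (A′ + B′ + γ))) where

    Q : ℕ
    Q = A′ + B′ + γ

    q′ : ℕ
    q′ = suc Q

    open Lucas q′ frob

    a b : ℕ
    a = suc A′ * q
    b = suc B′ * q′

    a∸1≡A′q+q′ : a ∸ 1 ≡ A′ * q + q′
    a∸1≡A′q+q′ = +-comm q′ (A′ * q)

    b∸1≡B′q+[A′+γ] : b ∸ 1 ≡ B′ * q + (A′ + γ)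
    b∸1≡B′q+[A′+γ] = shape A′ B′ γ
      where shape : ∀ A B g → (A + B + g) + B * suc (A + B + g) ≡ B * suc (suc (A + B + g)) + (A + g)
            shape = solve-∀

    [1+m]q′∸1≡mq+δ : ∀ m δ → m + δ ≡ Q → suc m * q′ ∸ 1 ≡ m * q + δ
    [1+m]q′∸1≡mq+δ m δ m+δ≡Q = subst (λ Q → Q + m * suc Q ≡ m * suc (suc Q) + δ) m+δ≡Q (shape m δ)
      where shape : ∀ m δ → (m + δ) + m * suc (m + δ) ≡ m * suc (suc (m + δ)) + δ
            shape = solve-∀

    qq′∸1≡Qq+q′ : q * q′ ∸ 1 ≡ Q * q + q′
    qq′∸1≡Qq+q′ = shape Q
      where shape : ∀ Q → Q + suc Q * suc Q ≡ Q * suc (suc Q) + suc Q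
            shape = solve-∀

    δ<q′ : ∀ m δ → m + δ ≡ Q → δ < q′
    δ<q′ m δ m+δ≡Q = s≤s (subst (δ ≤_) m+δ≡Q (m≤n+m δ m))

    B′+[A′+γ]≡Q : B′ + (A′ + γ) ≡ Q
    B′+[A′+γ]≡Q = shape A′ B′ γ
      where shape : ∀ A B g → B + (A + g) ≡ A + B + g
            shape = solve-∀

    A′+γ<q′ : A′ + γ < q′
    A′+γ<q′ = δ<q′ B′ (A′ + γ) B′+[A′+γ]≡Q

    a+b+slack≡[1+q]q′ : a + b + (γ * q′ + B′ + γ) ≡ suc q * q′
    a+b+slack≡[1+q]q′ = shape A′ B′ γ
      where shape : ∀ A B g → let Q = A + B + g in
                      suc A * suc (suc Q) + suc B * suc Q + (g * suc Q + B + g) ≡ suc Q + suc (suc Q) * suc Q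
            shape = solve-∀

    a+b≤[1+q]q′ : a + b ≤ suc q * q′
    a+b≤[1+q]q′ = subst (a + b ≤_) a+b+slack≡[1+q]q′ (m≤m+n (a + b) _)

    qq′<a+b⇒γ≡0 : q * q′ < a + b → γ ≡ 0
    qq′<a+b⇒γ≡0 qq′<a+b with 1 ℕ.≤? γ
    ... | no  γ≱1 = n<1⇒n≡0 (≰⇒> γ≱1)
    ... | yes γ≥1 = ⊥-elim (<⇒≱ qq′<a+b (+-cancelʳ-≤ q′ (a + b) (q * q′) a+b+q′≤qq′+q′))
      where
      q′≤slack : q′ ≤ γ * q′ + B′ + γ
      q′≤slack = ≤-trans (m≤n*m q′ γ {{ℕ.>-nonZero γ≥1}}) (≤-trans (m≤m+n _ B′) (m≤m+n _ γ))
      a+b+q′≤qq′+q′ : a + b + q′ ≤ q * q′ + q′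
      a+b+q′≤qq′+q′ = ≤-trans (+-monoʳ-≤ (a + b) q′≤slack)
                        (≤-reflexive (trans a+b+slack≡[1+q]q′ (+-comm q′ (q * q′))))

    sign-a : negOnePow (a ∸ 1) ≡ₚ negOnePow A′
    sign-a = begin
      negOnePow (q′ + A′ * q)                 ≡⟨ negOnePow-+ q′ (A′ * q) ⟩
      negOnePow q′ ℤ.* negOnePow (A′ * q)     ≈⟨ *-cong negOnePow-q′≡ₚ1 (negOnePow-*q≡ₚ A′) ⟩
      + 1 ℤ.* negOnePow A′                    ≡⟨ ℤP.*-identityˡ (negOnePow A′) ⟩
      negOnePow A′                            ∎

    sign-b : negOnePow (b ∸ 1) ≡ₚ -1ℤ
    sign-b = begin
      negOnePow (b ∸ 1)   ≡⟨ ℤP.neg-involutive (negOnePow (b ∸ 1)) ⟨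
      - negOnePow b       ≈⟨ -‿cong (negOnePow-*q′≡ₚ1 (suc B′)) ⟩
      -1ℤ                 ∎

    C-low-a : ∀ m δ → m + δ ≡ Q → + ((suc m * q′ ∸ 1) C (a ∸ 1)) ≡ₚ + 0
    C-low-a m δ m+δ≡Q = begin
      + ((suc m * q′ ∸ 1) C (a ∸ 1))
        ≡⟨ cong₂ (λ n k → + (n C k)) ([1+m]q′∸1≡mq+δ m δ m+δ≡Q) a∸1≡A′q+q′ ⟩
      + ((m * q + δ) C (A′ * q + q′))
        ≈⟨ lucas m A′ (m<n⇒m<1+n (δ<q′ m δ m+δ≡Q)) ≤-refl ⟩
      + ((m C A′) * (δ C q′))
        ≡⟨ cong (λ c → + ((m C A′) * c)) (k>n⇒nCk≡0 (δ<q′ m δ m+δ≡Q)) ⟩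
      + ((m C A′) * 0)
        ≡⟨ cong +_ (*-zeroʳ (m C A′)) ⟩
      + 0 ∎

    C-low-b : ∀ m δ → m + δ ≡ Q → m ≢ B′ → + ((suc m * q′ ∸ 1) C (b ∸ 1)) ≡ₚ + 0
    C-low-b m δ m+δ≡Q m≢B′ = begin
      + ((suc m * q′ ∸ 1) C (b ∸ 1))
        ≡⟨ cong₂ (λ n k → + (n C k)) ([1+m]q′∸1≡mq+δ m δ m+δ≡Q) b∸1≡B′q+[A′+γ] ⟩
      + ((m * q + δ) C (B′ * q + (A′ + γ)))
        ≈⟨ lucas m B′ (m<n⇒m<1+n (δ<q′ m δ m+δ≡Q)) (m<n⇒m<1+n A′+γ<q′) ⟩
      + ((m C B′) * (δ C (A′ + γ)))
        ≡⟨ cong +_ digits-vanish ⟩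
      + 0 ∎
      where
      digits-vanish : (m C B′) * (δ C (A′ + γ)) ≡ 0
      digits-vanish with <-cmp m B′
      ... | tri< m<B′ _ _    = cong (_* (δ C (A′ + γ))) (k>n⇒nCk≡0 m<B′)
      ... | tri≈ _ m≡B′ _    = ⊥-elim (m≢B′ m≡B′)
      ... | tri> _ _ B′<m    = trans (cong ((m C B′) *_) (k>n⇒nCk≡0 δ<A′+γ)) (*-zeroʳ (m C B′))
        where
        δ<A′+γ : δ < A′ + γ
        δ<A′+γ = +-cancelˡ-< m δ (A′ + γ)
                   (subst (_< m + (A′ + γ)) (trans B′+[A′+γ]≡Q (sym m+δ≡Q)) (+-monoˡ-< (A′ + γ) B′<m))

    C-top-a : + ((q * q′ ∸ 1) C (a ∸ 1)) ≡ₚ + (Q C A′)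
    C-top-a = begin
      + ((q * q′ ∸ 1) C (a ∸ 1))       ≡⟨ cong₂ (λ n k → + (n C k)) qq′∸1≡Qq+q′ a∸1≡A′q+q′ ⟩
      + ((Q * q + q′) C (A′ * q + q′))  ≈⟨ lucas Q A′ ≤-refl ≤-refl ⟩
      + ((Q C A′) * (q′ C q′))          ≡⟨ cong (λ c → + ((Q C A′) * c)) (nCn≡1 q′) ⟩
      + ((Q C A′) * 1)                  ≡⟨ cong +_ (*-identityʳ (Q C A′)) ⟩
      + (Q C A′)                        ∎

    C-top-b : + ((q * q′ ∸ 1) C (b ∸ 1)) ≡ₚ + (Q C (A′ + γ)) ℤ.* negOnePow (A′ + γ)
    C-top-b = begin
      + ((q * q′ ∸ 1) C (b ∸ 1))
        ≡⟨ cong₂ (λ n k → + (n C k)) qq′∸1≡Qq+q′ b∸1≡B′q+[A′+γ] ⟩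
      + ((Q * q + q′) C (B′ * q + (A′ + γ)))
        ≈⟨ lucas Q B′ ≤-refl (m<n⇒m<1+n A′+γ<q′) ⟩
      + ((Q C B′) * (q′ C (A′ + γ)))
        ≡⟨ ℤP.pos-* (Q C B′) (q′ C (A′ + γ)) ⟩
      + (Q C B′) ℤ.* + (q′ C (A′ + γ))
        ≈⟨ *-cong (≡⇒≡ₚ (cong +_ QCB′≡QC[A′+γ])) (C-pred-alternating (A′ + γ) (m<n⇒m<1+n A′+γ<q′)) ⟩
      + (Q C (A′ + γ)) ℤ.* negOnePow (A′ + γ) ∎
      where
      Q≡[A′+γ]+B′ : Q ≡ A′ + γ + B′
      Q≡[A′+γ]+B′ = trans (sym B′+[A′+γ]≡Q) (+-comm B′ (A′ + γ))
      QCB′≡QC[A′+γ] : Q C B′ ≡ Q C (A′ + γ)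
      QCB′≡QC[A′+γ] = trans (nCk≡nC[n∸k] (subst (B′ ≤_) (sym Q≡[A′+γ]+B′) (m≤n+m B′ (A′ + γ))))
                            (trans (cong (λ n → Q C (n ∸ B′)) Q≡[A′+γ]+B′) (cong (Q C_) (m+n∸n≡m (A′ + γ) B′)))

    Δ-formula-top : q * q′ < a + b → Δ-formula a b (q * q′) ≡ₚ + 0
    Δ-formula-top qq′<a+b = begin
      Δ-formula a b (q * q′)
        ≈⟨ +-cong (*-cong sign-a C-top-a) (*-cong sign-b C-top-b) ⟩
      negOnePow A′ ℤ.* + (Q C A′) ℤ.+ -1ℤ ℤ.* (+ (Q C (A′ + γ)) ℤ.* negOnePow (A′ + γ))
        ≡⟨ cong (λ k → negOnePow A′ ℤ.* + (Q C A′) ℤ.+ -1ℤ ℤ.* (+ (Q C k) ℤ.* negOnePow k)) A′+γ≡A′ ⟩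
      negOnePow A′ ℤ.* + (Q C A′) ℤ.+ -1ℤ ℤ.* (+ (Q C A′) ℤ.* negOnePow A′)
        ≡⟨ cancel (negOnePow A′) (+ (Q C A′)) ⟩
      + 0 ∎
      where
      A′+γ≡A′ : A′ + γ ≡ A′
      A′+γ≡A′ = trans (cong (λ g → A′ + g) (qq′<a+b⇒γ≡0 qq′<a+b)) (+-identityʳ A′)
      cancel : ∀ s x → s ℤ.* x ℤ.+ -1ℤ ℤ.* (x ℤ.* s) ≡ + 0
      cancel = ℤ-Solver.solve-∀

    Δ-formula-vanishes : ∀ m → m ≢ suc B′ → 0 < m * q′ → m * q′ < a + b →
                         Δ-formula a b (m * q′) ≡ₚ + 0
    Δ-formula-vanishes (suc m) m≢1+B′ _ mq′<a+b with <-cmp m q′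
    ... | tri< m<q′ _ _ =
      let δ , m+δ≡Q = m≤n⇒∃[o]m+o≡n (≤-pred m<q′)
      in Δ-formula≡ₚ0 a b (suc m * q′) (C-low-a m δ m+δ≡Q) (C-low-b m δ m+δ≡Q (m≢1+B′ ∘ cong suc))
    ... | tri≈ _ refl _ = Δ-formula-top mq′<a+b
    ... | tri> _ _ q′<m = ⊥-elim (<⇒≱ mq′<a+b (≤-trans a+b≤[1+q]q′ (*-monoˡ-≤ q′ (s≤s q′<m))))

    Δ-formula-at-b : Δ-formula a b b ≡ₚ -1ℤ
    Δ-formula-at-b = begin
      Δ-formula a b b
        ≈⟨ +-cong (*-cong (≡ₚ-refl {negOnePow (a ∸ 1)}) (C-low-a B′ (A′ + γ) B′+[A′+γ]≡Q))
                  (*-cong sign-b (≡⇒≡ₚ (cong +_ (nCn≡1 (b ∸ 1))))) ⟩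
      negOnePow (a ∸ 1) ℤ.* + 0 ℤ.+ -1ℤ ℤ.* + 1
        ≡⟨ cong (λ t → t ℤ.+ -1ℤ) (ℤP.*-zeroʳ (negOnePow (a ∸ 1))) ⟩
      -1ℤ ∎

    Δ-at-b : Δ q a b b ≡ₚ -1ℤ
    Δ-at-b = begin
      Δ q a b b       ≡⟨ Δ-on-support q a b b (ℕ∣.divides (suc B′) refl) (s≤s z≤n) (m<n+m b {a} (s≤s z≤n)) ⟩
      Δ-formula a b b ≈⟨ Δ-formula-at-b ⟩
      -1ℤ             ∎

    Δ-off-b : ∀ j → j ≢ b → Δ q a b j ≡ₚ + 0
    Δ-off-b j j≢b = Δ≡ₚ0 q a b j (on-support j≢b)
      where
      on-support : ∀ {j} → j ≢ b → ∀ m → j ≡ m * q′ → 0 < j → j < a + b → Δ-formula a b j ≡ₚ + 0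
      on-support j≢b m refl = Δ-formula-vanishes m (j≢b ∘ cong (_* q′))

    Δ-sum : ∀ w → sumℤ (map (λ j → Δ q a b j ℤ.* coeff w (word2 (a + b ∸ j) j)) (upTo (a + b)))
                  ≡ₚ - coeff w (word2 a b)
    Δ-sum w = begin
      sumℤ (map term (upTo (a + b)))
        ≡⟨ cong sumℤ (map-applyUpTo id term (a + b)) ⟩
      sumℤ (applyUpTo term (a + b))
        ≈⟨ sumℤ-applyUpTo-single term (a + b) b (m<n+m b {a} (s≤s z≤n)) (λ j j≢b → *-cong (Δ-off-b j j≢b) ≡ₚ-refl) ⟩
      Δ q a b b ℤ.* coeff w (word2 (a + b ∸ b) b)
        ≈⟨ *-cong Δ-at-b (≡⇒≡ₚ (cong (λ x → coeff w (word2 x b)) (m+n∸n≡m a b))) ⟩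
      -1ℤ ℤ.* coeff w (word2 a b)
        ≡⟨ ℤP.-1*i≡-i (coeff w (word2 a b)) ⟩
      - coeff w (word2 a b) ∎
      where
      term : ℕ → ℤ
      term j = Δ q a b j ℤ.* coeff w (word2 (a + b ∸ j) j)

    letter-⧢-letter≡ₚ : ∀ w → coeff w (letter a ⧢[ q ] letter b) ≡ₚ coeff w (letter (a + b) ⊕ word2 b a)
    letter-⧢-letter≡ₚ w = begin
      coeff w (letter a ⧢[ q ] letter b)
        ≡⟨ coeff-letter-⧢-letter q a b w ⟩
      x ℤ.+ (y ℤ.+ (z ℤ.+ sumℤ (map (λ j → Δ q a b j ℤ.* coeff w (word2 (a + b ∸ j) j)) (upTo (a + b)))))
        ≈⟨ +-cong (≡ₚ-refl {x}) (+-cong (≡ₚ-refl {y}) (+-cong (≡ₚ-refl {z}) (Δ-sum w))) ⟩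
      x ℤ.+ (y ℤ.+ (z ℤ.+ - x))
        ≡⟨ rearrange x y z ⟩
      z ℤ.+ y
        ≡⟨ coeff-++ w (letter (a + b)) (word2 b a) ⟨
      coeff w (letter (a + b) ⊕ word2 b a) ∎
      where
      x y z : ℤ
      x = coeff w (word2 a b)
      y = coeff w (word2 b a)
      z = coeff w (letter (a + b))
      rearrange : ∀ x y z → x ℤ.+ (y ℤ.+ (z ℤ.+ - x)) ≡ z ℤ.+ y
      rearrange = ℤ-Solver.solve-∀

2+[A+B+γ] : ∀ A B γ → 2 + (A + B + γ) ≡ suc A + suc B + γ
2+[A+B+γ] = solve-∀

lemma8p17 : (p k : ℕ) → Prime p → 1 ≤ k → (A B : ℕ) →
    let q = p ^ k in
    1 ≤ A → A ≤ q ∸ 1 → 1 ≤ B → B ≤ q ∸ 1 → A + B ≤ q →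
    (letter (A * q) ⧢[ q ] letter (B * (q ∸ 1)))
      ≈[ p ] (letter (A * q + B * (q ∸ 1)) ⊕ word2 (B * (q ∸ 1)) (A * q))
lemma8p17 p k p-prime _ (suc A′) (suc B′) _ _ _ _ A+B≤q with m≤n⇒∃[o]m+o≡n A+B≤q
... | γ , A+B+γ≡q with p ^ k | Modulo.PrimePower.frobenius-^ p p-prime k | trans (2+[A+B+γ] A′ B′ γ) A+B+γ≡q
...   | .(2 + (A′ + B′ + γ)) | frob | refl = λ w → ∣⇒∣ᵤ (p∣x-y (letter-⧢-letter≡ₚ w))
  where open Modulo p
        open LetterShuffle A′ B′ γ frob
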